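{- (1) Let $G$ be an icc-group and $A$ a subset of $G$. Then for every $i<\omega$ the iterated centralizer $C^i_G(A)$ and the $i$-th term $Z_i(G)$ of the upper central series are definable. (2) Let $G$ be a sub-icc group, $A$ a subset of $G$ and $H$ a relatively definable subgroup of $G$. Then for every $i<\omega$ the iterated centralizer $C^i_H(A)$ and the $i$-th term $Z_i(G)$ of the upper central series are definable relative to $G$.
   Context: Iterated centralizers: $C^0_H(A)=\{1\}$, $C^1_H(A)=C_H(A)$, and for $i\ge1$, $C^i_H(A)$ is the set of $h\in H$ normalizing $C^j_H(A)$ for all $j<i$ and such that $[h,a]\in C^{i-1}_H(A)$ for all $a\in A$ (i.e. $h$ centralizes $A$ modulo $C^{i-1}_H(A)$). For a group $X$, a definable subgroup is one of the form $\phi(X,\bar a)=\{g\in X: X\models\phi(g,\bar a)\}$ for a first-order formula $\phi(x,\bar y)$ in the language of groups and parameters $\bar a$ from $X$. $X$ is an icc-group if for each formula $\phi(x,\bar y)$ there is a bound $n_\phi$ on the length of every chain of subgroups each of which is an intersection $\bigcap_i\phi(X,\bar a_i)$ of subgroups defined by $\phi$. A group $G$ is sub-icc if it is a subgroup of an icc-group $X$; a subgroup of $G$ is definable relative to $G$ if it equals $D\cap G$ for a definable subgroup $D$ of $X$. -}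

module Defs where

open import Level using (Level; Lift; lift; _⊔_) renaming (suc to lsuc)
open import Algebra.Bundles using (Group)
open import Data.Nat using (ℕ; zero; suc; _≤_)
open import Data.Fin using (Fin; inject₁) renaming (zero to fzero; suc to fsuc)
open import Data.Vec using (Vec; _∷_; lookup)
open import Data.Product using (Σ; _×_; _,_; ∃)
open import Data.Sum using (_⊎_)
open import Data.Empty.Polymorphic using (⊥)
open import Data.Unit.Polymorphic using (⊤)
open import Relation.Nullary using (¬_)
open import Relation.Unary using (Pred)

data Term (n : ℕ) : Set where
  var  : Fin n → Term n
  one  : Term n
  _·_  : Term n → Term n → Term n
  inv  : Term n → Term n

data Formula (n : ℕ) : Set where
  _≐_  : Term n → Term n → Formula n
  falsum : Formula n
  _∧'_ _∨'_ _⇒'_ : Formula n → Formula n → Formula n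
  all' ex' : Formula (suc n) → Formula n

module GroupTheory {ℓ : Level} (X : Group ℓ ℓ) where
  open Group X

  Subset : Set (lsuc ℓ)
  Subset = Pred Carrier ℓ

  U : Subset
  U _ = ⊤

  ⟦_⟧t : ∀ {n} → Term n → Vec Carrier n → Carrier
  ⟦ var i ⟧t ρ = lookup ρ i
  ⟦ one ⟧t ρ = ε
  ⟦ s · t ⟧t ρ = ⟦ s ⟧t ρ ∙ ⟦ t ⟧t ρ
  ⟦ inv t ⟧t ρ = ⟦ t ⟧t ρ ⁻¹

  Sat : ∀ {n} → Formula n → Vec Carrier n → Set ℓ
  Sat (s ≐ t) ρ = ⟦ s ⟧t ρ ≈ ⟦ t ⟧t ρ
  Sat falsum ρ = ⊥
  Sat (φ ∧' ψ) ρ = Sat φ ρ × Sat ψ ρ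
  Sat (φ ∨' ψ) ρ = Sat φ ρ ⊎ Sat ψ ρ
  Sat (φ ⇒' ψ) ρ = Sat φ ρ → Sat ψ ρ
  Sat (all' φ) ρ = ∀ g → Sat φ (g ∷ ρ)
  Sat (ex' φ) ρ = Σ Carrier λ g → Sat φ (g ∷ ρ)

  -- φ(X, ā) = { g ∈ X : X ⊨ φ(g, ā) }  (variable 0 is x, the rest are ȳ)
  DefSet : ∀ {m} → Formula (suc m) → Vec Carrier m → Subset
  DefSet φ ā g = Sat φ (g ∷ ā)

  _⊆_ : Subset → Subset → Set ℓ
  S ⊆ T = ∀ g → S g → T g

  _≗_ : Subset → Subset → Set ℓ
  S ≗ T = (S ⊆ T) × (T ⊆ S)

  _⊂_ : Subset → Subset → Set ℓ
  S ⊂ T = (S ⊆ T) × ¬ (T ⊆ S)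

  _∩_ : Subset → Subset → Subset
  (S ∩ T) g = S g × T g

  record IsSubgroup (S : Subset) : Set ℓ where
    field
      resp  : ∀ {g h} → g ≈ h → S g → S h
      ε∈    : S ε
      ∙-closed : ∀ {g h} → S g → S h → S (g ∙ h)
      ⁻¹-closed : ∀ {g} → S g → S (g ⁻¹)

  Definable : Subset → Set ℓ
  Definable S = Σ ℕ λ m → Σ (Formula (suc m)) λ φ → Σ (Vec Carrier m) λ ā →
                  S ≗ DefSet φ ā

  DefinableSubgroup : Subset → Set ℓ
  DefinableSubgroup S = IsSubgroup S × Definable S

  RelDefinable : Subset → Subset → Set (lsuc ℓ)
  RelDefinable G S = Σ Subset λ D → DefinableSubgroup D × (S ≗ (D ∩ G))

  IsφIntersection : ∀ {m} → Formula (suc m) → Subset → Set (lsuc ℓ)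
  IsφIntersection {m} φ S =
    Σ (Pred (Vec Carrier m) ℓ) λ P →
      (∀ ā → P ā → IsSubgroup (DefSet φ ā)) ×
      (S ≗ (λ g → ∀ ā → P ā → DefSet φ ā g))

  IsICC : Set (lsuc ℓ)
  IsICC = ∀ m (φ : Formula (suc m)) → Σ ℕ λ n →
            ∀ k (H : Fin (suc k) → Subset) →
            (∀ j → IsφIntersection φ (H j)) →
            (∀ (j : Fin k) → H (fsuc j) ⊂ H (inject₁ j)) →
            k ≤ n

  [_,_] : Carrier → Carrier → Carrier
  [ g , h ] = ((g ⁻¹ ∙ h ⁻¹) ∙ g) ∙ h

  Normalizes : Carrier → Subset → Set ℓ
  Normalizes h S = (∀ x → S x → S ((h ∙ x) ∙ h ⁻¹)) ×
                   (∀ x → S x → S ((h ⁻¹ ∙ x) ∙ h))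

  mutual
    C : (H A : Subset) → ℕ → Subset
    C H A zero h = H h × (h ≈ ε)
    C H A (suc i) h = H h × NormAll H A i h × (∀ a → A a → C H A i [ h , a ])

    NormAll : (H A : Subset) → ℕ → Carrier → Set ℓ
    NormAll H A zero h = Normalizes h (C H A zero)
    NormAll H A (suc i) h = NormAll H A i h × Normalizes h (C H A (suc i))

  Z : (G : Subset) → ℕ → Subset
  Z G zero g = G g × (g ≈ ε)
  Z G (suc i) g = G g × (∀ x → G x → Z G i [ g , x ])

module Submission where

-- Let X be an icc-group and G ≤ X.  The proof has four ingredients.
--  * Expressibility: sets defined by formulas with parameters are closed under
--    the connectives, quantifiers and substitution of group words; hence
--    normalizers and finite intersections of definable sets are definable.
--  * Chain condition: an intersection ⋂_{ā ∈ P} φ(X,ā) of subgroups is definable,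
--    since (by excluded middle) it equals a finite sub-intersection: otherwise
--    one builds strictly descending chains of φ-intersections of every length.
--  * Normal core: if S = D ∩ G with D a definable subgroup, then
--    D* = ⋂_{g ∈ N_G(S)} (D ∩ D^g) is a definable subgroup with S = D* ∩ G, and an
--    element of G normalizes S iff it normalizes D*.
--  * Induction on i: definable subgroups Dᵢ, Mᵢ with C^i_H(A) = Dᵢ ∩ G,
--    Mᵢ ∩ G = {h ∈ H : h normalizes C^j_H(A) for j ≤ i} and Mᵢ normalizing Dᵢ give
--    C^{i+1}_H(A) = (Mᵢ ∩ ⋂_{a ∈ A} {h ∈ Mᵢ : [h,a] ∈ Dᵢ}) ∩ G.
-- Finally Z_i(G) = C^i_G(G), and part (1) is part (2) for G = H = X.

open import Defs
open import Level using (Level)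
open import Algebra.Bundles using (Group)
open import Data.Nat using (ℕ)
open import Data.Product using (_×_)
open import Axiom.ExcludedMiddle using (ExcludedMiddle)

import Algebra.Properties.Group as GroupProperties
open import Level using () renaming (suc to lsuc)
open import Data.Bool using (Bool; true; false; not)
open import Data.Empty using (⊥-elim)
open import Data.Fin using (Fin; inject₁; toℕ; _↑ˡ_; _↑ʳ_) renaming (zero to fzero; suc to fsuc)
open import Data.Fin.Properties using (toℕ-inject₁; toℕ<n; toℕ≤pred[n]) renaming (_≟_ to _≟ᶠ_)
open import Data.List using (List; []; _∷_)
open import Data.Nat using (zero; suc; _+_; _≤_; _<_; _≟_)
open import Data.Nat.Properties
  using (m<1+n⇒m<n∨m≡n; <-irrefl; <-≤-trans; m<n⇒m<1+n; n<1+n; <⇒≤; ≤-refl)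
open import Data.Product using (Σ; ∃; _,_; proj₁; proj₂)
open import Data.Product.Function.NonDependent.Propositional using (_×-⇔_)
open import Data.Sum using (_⊎_; inj₁; inj₂)
open import Data.Sum.Function.Propositional using (_⊎-⇔_)
open import Data.Unit.Polymorphic using (⊤; tt)
open import Data.Vec using (Vec; []; _∷_; lookup; _++_; tabulate; head; replicate)
open import Data.Vec.Properties using (lookup-++ˡ; lookup-++ʳ)
open import Function using (_∘_; id)
open import Function.Bundles using (_⇔_; mk⇔; module Equivalence)
open import Function.Construct.Composition using (_⇔-∘_)
open import Function.Construct.Symmetry using (⇔-sym)
open import Function.Related.TypeIsomorphisms using (→-cong-⇔)
open import Relation.Nullary using (¬_; yes; no)
open import Relation.Nullary.Decidable using (decidable-stable)
open import Relation.Binary.PropositionalEquality as ≡ using (_≡_)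

open Equivalence using (to; from)

substT : ∀ {n k} → (Fin n → Term k) → Term n → Term k
substT σ (var i) = σ i
substT σ one     = one
substT σ (s · t) = substT σ s · substT σ t
substT σ (inv t) = inv (substT σ t)

renameT : ∀ {n k} → (Fin n → Fin k) → Term n → Term k
renameT f = substT (var ∘ f)

liftS : ∀ {n k} → (Fin n → Term k) → Fin (suc n) → Term (suc k)
liftS σ fzero    = var fzero
liftS σ (fsuc i) = renameT fsuc (σ i)

substF : ∀ {n k} → (Fin n → Term k) → Formula n → Formula k
substF σ (s ≐ t)  = substT σ s ≐ substT σ t
substF σ falsum   = falsum
substF σ (φ ∧' ψ) = substF σ φ ∧' substF σ ψ
substF σ (φ ∨' ψ) = substF σ φ ∨' substF σ ψ
substF σ (φ ⇒' ψ) = substF σ φ ⇒' substF σ ψ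
substF σ (all' φ) = all' (substF (liftS σ) φ)
substF σ (ex' φ)  = ex' (substF (liftS σ) φ)

-- Reindexing variables (x̄, ā₁) resp. (x̄, ā₂) into (x̄, ā₁, ā₂); this lets two
-- formulas with separate parameter lists share one list.
embedˡ : ∀ n {m₁} m₂ → Fin (n + m₁) → Fin (n + (m₁ + m₂))
embedˡ zero    m₂ i        = i ↑ˡ m₂
embedˡ (suc n) m₂ fzero    = fzero
embedˡ (suc n) m₂ (fsuc i) = fsuc (embedˡ n m₂ i)

embedʳ : ∀ n m₁ {m₂} → Fin (n + m₂) → Fin (n + (m₁ + m₂))
embedʳ zero    m₁ i        = m₁ ↑ʳ i
embedʳ (suc n) m₁ fzero    = fzero
embedʳ (suc n) m₁ (fsuc i) = fsuc (embedʳ n m₁ i)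

substPrefix : ∀ n {k m} → (Fin n → Term k) → Fin (n + m) → Term (k + m)
substPrefix zero {k} σ j            = var (k ↑ʳ j)
substPrefix (suc n) {m = m} σ fzero  = renameT (_↑ˡ m) (σ fzero)
substPrefix (suc n) σ (fsuc i)       = substPrefix n (σ ∘ fsuc) i

x₀ : ∀ {n} → Term (suc n)
x₀ = var fzero

x₁ : ∀ {n} → Term (suc (suc n))
x₁ = var (fsuc fzero)

x₂ : ∀ {n} → Term (suc (suc (suc n)))
x₂ = var (fsuc (fsuc fzero))

conjᵗ conjᵗ⁻ : ∀ {n} → Term n → Term n → Term n
conjᵗ g x  = (g · x) · inv g
conjᵗ⁻ g x = (inv g · x) · g

commᵗ : ∀ {n} → Term n → Term n → Term n
commᵗ g h = ((inv g · inv h) · g) · h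

module Semantics {ℓ : Level} (X : Group ℓ ℓ) where
  open Group X
  open GroupTheory X

  Realises : ∀ {n k} → (Fin n → Term k) → Vec Carrier k → Vec Carrier n → Set ℓ
  Realises σ τ ρ = ∀ i → ⟦ σ i ⟧t τ ≡ lookup ρ i

  eval-substT : ∀ {n k} {σ : Fin n → Term k} {τ ρ} → Realises σ τ ρ →
                ∀ t → ⟦ substT σ t ⟧t τ ≡ ⟦ t ⟧t ρ
  eval-substT r (var i) = r i
  eval-substT r one     = ≡.refl
  eval-substT r (s · t) = ≡.cong₂ _∙_ (eval-substT r s) (eval-substT r t)
  eval-substT r (inv t) = ≡.cong _⁻¹ (eval-substT r t)

  realises-liftS : ∀ {n k} {σ : Fin n → Term k} {τ ρ} → Realises σ τ ρ →
                   ∀ g → Realises (liftS σ) (g ∷ τ) (g ∷ ρ)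
  realises-liftS r g fzero = ≡.refl
  realises-liftS {σ = σ} r g (fsuc i) = ≡.trans (eval-substT (λ _ → ≡.refl) (σ i)) (r i)

  sat-substF : ∀ {n k} {σ : Fin n → Term k} {τ ρ} → Realises σ τ ρ →
               ∀ φ → Sat (substF σ φ) τ ⇔ Sat φ ρ
  sat-substF {σ = σ} {τ} {ρ} r (s ≐ t)
    rewrite eval-substT {σ = σ} {τ} {ρ} r s | eval-substT {σ = σ} {τ} {ρ} r t = mk⇔ id id
  sat-substF r falsum   = mk⇔ id id
  sat-substF r (φ ∧' ψ) = sat-substF r φ ×-⇔ sat-substF r ψ
  sat-substF r (φ ∨' ψ) = sat-substF r φ ⊎-⇔ sat-substF r ψ
  sat-substF r (φ ⇒' ψ) = →-cong-⇔ (sat-substF r φ) (sat-substF r ψ)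
  sat-substF r (all' φ) = mk⇔
    (λ f g → to (sat-substF (realises-liftS r g) φ) (f g))
    (λ f g → from (sat-substF (realises-liftS r g) φ) (f g))
  sat-substF r (ex' φ) = mk⇔
    (λ (g , s) → g , to (sat-substF (realises-liftS r g) φ) s)
    (λ (g , s) → g , from (sat-substF (realises-liftS r g) φ) s)

  realises-substPrefix : ∀ n {k m} (σ : Fin n → Term k) (τ : Vec Carrier k) (ā : Vec Carrier m) →
    Realises (substPrefix n σ) (τ ++ ā) (tabulate (λ j → ⟦ σ j ⟧t τ) ++ ā)
  realises-substPrefix zero σ τ ā i = lookup-++ʳ τ ā i
  realises-substPrefix (suc n) {m = m} σ τ ā fzero = eval-substT (lookup-++ˡ τ ā) (σ fzero)
  realises-substPrefix (suc n) σ τ ā (fsuc i) = realises-substPrefix n (σ ∘ fsuc) τ ā i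

  realises-embedˡ : ∀ {n m₁ m₂} (ρ : Vec Carrier n) (ā₁ : Vec Carrier m₁) (ā₂ : Vec Carrier m₂) →
    Realises (var ∘ embedˡ n m₂) (ρ ++ (ā₁ ++ ā₂)) (ρ ++ ā₁)
  realises-embedˡ []      ā₁ ā₂ i        = lookup-++ˡ ā₁ ā₂ i
  realises-embedˡ (x ∷ ρ) ā₁ ā₂ fzero    = ≡.refl
  realises-embedˡ (x ∷ ρ) ā₁ ā₂ (fsuc i) = realises-embedˡ ρ ā₁ ā₂ i

  realises-embedʳ : ∀ {n m₁ m₂} (ρ : Vec Carrier n) (ā₁ : Vec Carrier m₁) (ā₂ : Vec Carrier m₂) →
    Realises (var ∘ embedʳ n m₁) (ρ ++ (ā₁ ++ ā₂)) (ρ ++ ā₂)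
  realises-embedʳ []      ā₁ ā₂ i        = lookup-++ʳ ā₁ ā₂ i
  realises-embedʳ (x ∷ ρ) ā₁ ā₂ fzero    = ≡.refl
  realises-embedʳ (x ∷ ρ) ā₁ ā₂ (fsuc i) = realises-embedʳ ρ ā₁ ā₂ i

module Expressibility {ℓ : Level} (X : Group ℓ ℓ) where
  open Group X
  open GroupTheory X
  open Semantics X

  record Expressible (n : ℕ) (Q : Vec Carrier n → Set ℓ) : Set ℓ where
    constructor expressible
    field
      arity   : ℕ
      formula : Formula (n + arity)
      params  : Vec Carrier arity
      meaning : ∀ ρ → Sat formula (ρ ++ params) ⇔ Q ρ

  expr-⇔ : ∀ {n Q Q'} → Expressible n Q → (∀ ρ → Q ρ ⇔ Q' ρ) → Expressible n Q'
  expr-⇔ (expressible m φ ā h) e = expressible m φ ā (λ ρ → e ρ ⇔-∘ h ρ)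

  expr-≈ : ∀ {n} (s t : Term n) → Expressible n (λ ρ → ⟦ s ⟧t ρ ≈ ⟦ t ⟧t ρ)
  expr-≈ s t = expressible 0 (substF (var ∘ (_↑ˡ 0)) (s ≐ t)) []
    (λ ρ → sat-substF (lookup-++ˡ ρ []) (s ≐ t))

  expr-⊤ : ∀ {n} → Expressible n (λ _ → ⊤)
  expr-⊤ = expr-⇔ (expr-≈ one one) (λ ρ → mk⇔ (λ _ → tt) (λ _ → refl))

  record Joint (n : ℕ) (Q₁ Q₂ : Vec Carrier n → Set ℓ) : Set ℓ where
    field
      arity              : ℕ
      formula₁ formula₂  : Formula (n + arity)
      params             : Vec Carrier arity
      meaning₁           : ∀ ρ → Sat formula₁ (ρ ++ params) ⇔ Q₁ ρ
      meaning₂           : ∀ ρ → Sat formula₂ (ρ ++ params) ⇔ Q₂ ρ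

  joint : ∀ {n Q₁ Q₂} → Expressible n Q₁ → Expressible n Q₂ → Joint n Q₁ Q₂
  joint {n} (expressible m₁ φ₁ ā₁ h₁) (expressible m₂ φ₂ ā₂ h₂) = record
    { arity    = m₁ + m₂
    ; formula₁ = substF (var ∘ embedˡ n m₂) φ₁
    ; formula₂ = substF (var ∘ embedʳ n m₁) φ₂
    ; params   = ā₁ ++ ā₂
    ; meaning₁ = λ ρ → h₁ ρ ⇔-∘ sat-substF (realises-embedˡ ρ ā₁ ā₂) φ₁
    ; meaning₂ = λ ρ → h₂ ρ ⇔-∘ sat-substF (realises-embedʳ ρ ā₁ ā₂) φ₂ }

  expr-∧ : ∀ {n Q₁ Q₂} → Expressible n Q₁ → Expressible n Q₂ →
           Expressible n (λ ρ → Q₁ ρ × Q₂ ρ)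
  expr-∧ e₁ e₂ = let open Joint (joint e₁ e₂) in
    expressible arity (formula₁ ∧' formula₂) params (λ ρ → meaning₁ ρ ×-⇔ meaning₂ ρ)

  expr-⇒ : ∀ {n Q₁ Q₂} → Expressible n Q₁ → Expressible n Q₂ →
           Expressible n (λ ρ → Q₁ ρ → Q₂ ρ)
  expr-⇒ e₁ e₂ = let open Joint (joint e₁ e₂) in
    expressible arity (formula₁ ⇒' formula₂) params (λ ρ → →-cong-⇔ (meaning₁ ρ) (meaning₂ ρ))

  expr-∀ : ∀ {n Q} → Expressible (suc n) Q → Expressible n (λ ρ → ∀ g → Q (g ∷ ρ))
  expr-∀ (expressible m φ ā h) = expressible m (all' φ) ā λ ρ →
    mk⇔ (λ f g → to (h (g ∷ ρ)) (f g)) (λ f g → from (h (g ∷ ρ)) (f g))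

  expr-subst : ∀ {n k Q} → Expressible n Q → (σ : Fin n → Term k) →
               Expressible k (λ τ → Q (tabulate (λ j → ⟦ σ j ⟧t τ)))
  expr-subst {n} (expressible m φ ā h) σ = expressible m (substF (substPrefix n σ) φ) ā
    (λ τ → h _ ⇔-∘ sat-substF (realises-substPrefix n σ τ ā) φ)

  toDefinable : ∀ {Q} → Expressible 1 Q → Definable (λ g → Q (g ∷ []))
  toDefinable (expressible m φ ā h) =
    m , φ , ā , (λ g → from (h (g ∷ []))) , (λ g → to (h (g ∷ [])))

  fromDefinable : ∀ {S} → Definable S → Expressible 1 (λ ρ → S (head ρ))
  fromDefinable (m , φ , ā , S⊆φ , φ⊆S) =
    expressible m φ ā (λ { (g ∷ []) → mk⇔ (φ⊆S g) (S⊆φ g) })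

  definable-⇔ : ∀ {S S'} → Definable S → (∀ g → S g ⇔ S' g) → Definable S'
  definable-⇔ {S' = S'} d e =
    toDefinable (expr-⇔ {Q' = S' ∘ head} (fromDefinable d) (λ { (g ∷ []) → e g }))

  U-definable : Definable U
  U-definable = toDefinable expr-⊤

  definable-∩ : ∀ {S T} → Definable S → Definable T → Definable (S ∩ T)
  definable-∩ d e = toDefinable (expr-∧ (fromDefinable d) (fromDefinable e))

-- Verifying group identities: a word is normalized to a list of letters x or
-- x⁻¹ with adjacent inverse pairs cancelled; equal normal forms give equal values.
module Words {ℓ : Level} (X : Group ℓ ℓ) where
  open Group X
  open GroupProperties X using (ε⁻¹≈ε; ⁻¹-involutive; ⁻¹-anti-homo-∙)
  open GroupTheory X
  open import Relation.Binary.Reasoning.Setoid setoid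

  Letter : ℕ → Set
  Letter n = Fin n × Bool

  module _ {n : ℕ} (ρ : Vec Carrier n) where
    evalLetter : Letter n → Carrier
    evalLetter (i , true)  = lookup ρ i
    evalLetter (i , false) = lookup ρ i ⁻¹

    evalWord : List (Letter n) → Carrier
    evalWord []      = ε
    evalWord (x ∷ w) = evalLetter x ∙ evalWord w

  invLetter : ∀ {n} → Letter n → Letter n
  invLetter (i , b) = i , not b

  cons : ∀ {n} → Letter n → List (Letter n) → List (Letter n)
  cons x [] = x ∷ []
  cons (i , b) ((j , c) ∷ w) with i ≟ᶠ j
  cons (i , true)  ((j , false) ∷ w) | yes _ = w
  cons (i , false) ((j , true)  ∷ w) | yes _ = w
  cons (i , true)  ((j , true)  ∷ w) | yes _ = (i , true) ∷ (j , true) ∷ w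
  cons (i , false) ((j , false) ∷ w) | yes _ = (i , false) ∷ (j , false) ∷ w
  cons (i , b)     ((j , c)     ∷ w) | no _  = (i , b) ∷ (j , c) ∷ w

  cons-correct : ∀ {n} (ρ : Vec Carrier n) x w → evalWord ρ (cons x w) ≈ evalLetter ρ x ∙ evalWord ρ w
  cons-correct ρ x [] = refl
  cons-correct ρ (i , b) ((j , c) ∷ w) with i ≟ᶠ j
  cons-correct ρ (i , true)  ((j , false) ∷ w) | yes ≡.refl = sym (begin
    lookup ρ i ∙ (lookup ρ i ⁻¹ ∙ evalWord ρ w) ≈⟨ assoc _ _ _ ⟨
    (lookup ρ i ∙ lookup ρ i ⁻¹) ∙ evalWord ρ w ≈⟨ ∙-congʳ (inverseʳ _) ⟩
    ε ∙ evalWord ρ w                            ≈⟨ identityˡ _ ⟩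
    evalWord ρ w                                ∎)
  cons-correct ρ (i , false) ((j , true)  ∷ w) | yes ≡.refl = sym (begin
    lookup ρ i ⁻¹ ∙ (lookup ρ i ∙ evalWord ρ w) ≈⟨ assoc _ _ _ ⟨
    (lookup ρ i ⁻¹ ∙ lookup ρ i) ∙ evalWord ρ w ≈⟨ ∙-congʳ (inverseˡ _) ⟩
    ε ∙ evalWord ρ w                            ≈⟨ identityˡ _ ⟩
    evalWord ρ w                                ∎)
  cons-correct ρ (i , true)  ((j , true)  ∷ w) | yes _ = refl
  cons-correct ρ (i , false) ((j , false) ∷ w) | yes _ = refl
  cons-correct ρ (i , b)     ((j , c)     ∷ w) | no _  = refl

  append : ∀ {n} → List (Letter n) → List (Letter n) → List (Letter n)
  append []      v = v
  append (x ∷ w) v = cons x (append w v)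

  append-correct : ∀ {n} (ρ : Vec Carrier n) w v → evalWord ρ (append w v) ≈ evalWord ρ w ∙ evalWord ρ v
  append-correct ρ []      v = sym (identityˡ _)
  append-correct ρ (x ∷ w) v = begin
    evalWord ρ (cons x (append w v))         ≈⟨ cons-correct ρ x (append w v) ⟩
    evalLetter ρ x ∙ evalWord ρ (append w v) ≈⟨ ∙-congˡ (append-correct ρ w v) ⟩
    evalLetter ρ x ∙ (evalWord ρ w ∙ evalWord ρ v) ≈⟨ assoc _ _ _ ⟨
    (evalLetter ρ x ∙ evalWord ρ w) ∙ evalWord ρ v ∎

  reverseInv : ∀ {n} → List (Letter n) → List (Letter n) → List (Letter n)
  reverseInv []      acc = acc
  reverseInv (x ∷ w) acc = reverseInv w (cons (invLetter x) acc)

  invLetter-correct : ∀ {n} (ρ : Vec Carrier n) x → evalLetter ρ (invLetter x) ≈ evalLetter ρ x ⁻¹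
  invLetter-correct ρ (i , true)  = refl
  invLetter-correct ρ (i , false) = sym (⁻¹-involutive _)

  reverseInv-correct : ∀ {n} (ρ : Vec Carrier n) w acc →
    evalWord ρ (reverseInv w acc) ≈ evalWord ρ w ⁻¹ ∙ evalWord ρ acc
  reverseInv-correct ρ [] acc = sym (trans (∙-congʳ ε⁻¹≈ε) (identityˡ _))
  reverseInv-correct ρ (x ∷ w) acc = begin
    evalWord ρ (reverseInv w (cons (invLetter x) acc))     ≈⟨ reverseInv-correct ρ w _ ⟩
    evalWord ρ w ⁻¹ ∙ evalWord ρ (cons (invLetter x) acc)   ≈⟨ ∙-congˡ (cons-correct ρ _ acc) ⟩
    evalWord ρ w ⁻¹ ∙ (evalLetter ρ (invLetter x) ∙ evalWord ρ acc)
                                                          ≈⟨ ∙-congˡ (∙-congʳ (invLetter-correct ρ x)) ⟩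
    evalWord ρ w ⁻¹ ∙ (evalLetter ρ x ⁻¹ ∙ evalWord ρ acc)  ≈⟨ assoc _ _ _ ⟨
    (evalWord ρ w ⁻¹ ∙ evalLetter ρ x ⁻¹) ∙ evalWord ρ acc  ≈⟨ ∙-congʳ (⁻¹-anti-homo-∙ _ _) ⟨
    (evalLetter ρ x ∙ evalWord ρ w) ⁻¹ ∙ evalWord ρ acc    ∎

  normalForm : ∀ {n} → Term n → List (Letter n)
  normalForm (var i) = (i , true) ∷ []
  normalForm one     = []
  normalForm (s · t) = append (normalForm s) (normalForm t)
  normalForm (inv t) = reverseInv (normalForm t) []

  normalForm-correct : ∀ {n} (ρ : Vec Carrier n) t → ⟦ t ⟧t ρ ≈ evalWord ρ (normalForm t)
  normalForm-correct ρ (var i) = sym (identityʳ _)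
  normalForm-correct ρ one     = refl
  normalForm-correct ρ (s · t) = trans (∙-cong (normalForm-correct ρ s) (normalForm-correct ρ t))
                                       (sym (append-correct ρ (normalForm s) (normalForm t)))
  normalForm-correct ρ (inv t) = trans (⁻¹-cong (normalForm-correct ρ t))
    (trans (sym (identityʳ _)) (sym (reverseInv-correct ρ (normalForm t) [])))

  solve : ∀ {n} (s t : Term n) → normalForm s ≡ normalForm t → (ρ : Vec Carrier n) → ⟦ s ⟧t ρ ≈ ⟦ t ⟧t ρ
  solve s t eq ρ = begin
    ⟦ s ⟧t ρ                ≈⟨ normalForm-correct ρ s ⟩
    evalWord ρ (normalForm s) ≡⟨ ≡.cong (evalWord ρ) eq ⟩
    evalWord ρ (normalForm t) ≈⟨ normalForm-correct ρ t ⟨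
    ⟦ t ⟧t ρ                ∎

  conj : Carrier → Carrier → Carrier
  conj g x = (g ∙ x) ∙ g ⁻¹

  conj-cong : ∀ {g g' x x'} → g ≈ g' → x ≈ x' → conj g x ≈ conj g' x'
  conj-cong e f = ∙-cong (∙-cong e f) (⁻¹-cong e)

  conj-ε : ∀ x → conj ε x ≈ x
  conj-ε x = solve {1} (conjᵗ one x₀) x₀ ≡.refl (x ∷ [])

  conj-∙ : ∀ g h x → conj (g ∙ h) x ≈ conj g (conj h x)
  conj-∙ g h x = solve (conjᵗ (x₀ · x₁) x₂) (conjᵗ x₀ (conjᵗ x₁ x₂)) ≡.refl (g ∷ h ∷ x ∷ [])

  conj⁻ : ∀ g x → (g ⁻¹ ∙ x) ∙ g ≈ conj (g ⁻¹) x
  conj⁻ g x = solve (conjᵗ⁻ x₀ x₁) (conjᵗ (inv x₀) x₁) ≡.refl (g ∷ x ∷ [])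

  comm-congˡ : ∀ {g g'} a → g ≈ g' → [ g , a ] ≈ [ g' , a ]
  comm-congˡ a e = ∙-congʳ (∙-cong (∙-congʳ (⁻¹-cong e)) e)

  comm-ε : ∀ a → [ ε , a ] ≈ ε
  comm-ε a = solve {1} (commᵗ one x₀) one ≡.refl (a ∷ [])

  comm-∙ : ∀ h k a → [ h ∙ k , a ] ≈ conj (k ⁻¹) [ h , a ] ∙ [ k , a ]
  comm-∙ h k a = solve (commᵗ (x₀ · x₁) x₂) (conjᵗ (inv x₁) (commᵗ x₀ x₂) · commᵗ x₁ x₂)
                       ≡.refl (h ∷ k ∷ a ∷ [])

  comm-inv : ∀ h a → [ h ⁻¹ , a ] ≈ conj h ([ h , a ] ⁻¹)
  comm-inv h a = solve (commᵗ (inv x₀) x₁) (conjᵗ x₀ (inv (commᵗ x₀ x₁))) ≡.refl (h ∷ a ∷ [])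

  comm-conj : ∀ g x y → [ conj g x , y ] ≈ conj g [ x , conj (g ⁻¹) y ]
  comm-conj g x y = solve (commᵗ (conjᵗ x₀ x₁) x₂) (conjᵗ x₀ (commᵗ x₁ (conjᵗ (inv x₀) x₂)))
                          ≡.refl (g ∷ x ∷ y ∷ [])

module Subgroups {ℓ : Level} (X : Group ℓ ℓ) where
  open Group X
  open GroupTheory X
  open Expressibility X
  open Words X
  open IsSubgroup

  subgroup-⇔ : ∀ {S S'} → IsSubgroup S → (∀ x → S x ⇔ S' x) → IsSubgroup S'
  subgroup-⇔ s e = record
    { resp      = λ {g} {h} q x → to (e h) (resp s q (from (e g) x))
    ; ε∈        = to (e ε) (ε∈ s)
    ; ∙-closed  = λ {g} {h} x y → to (e _) (∙-closed s (from (e g) x) (from (e h) y))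
    ; ⁻¹-closed = λ {g} x → to (e _) (⁻¹-closed s (from (e g) x)) }

  subgroup-≗ : ∀ {S T} → IsSubgroup T → S ≗ T → IsSubgroup S
  subgroup-≗ t (S⊆T , T⊆S) = subgroup-⇔ t (λ x → mk⇔ (T⊆S x) (S⊆T x))

  U-subgroup : IsSubgroup U
  U-subgroup = record { resp = λ _ _ → tt ; ε∈ = tt ; ∙-closed = λ _ _ → tt ; ⁻¹-closed = λ _ → tt }

  trivial-subgroup : IsSubgroup (λ x → x ≈ ε)
  trivial-subgroup = record
    { resp      = λ q x≈ε → trans (sym q) x≈ε
    ; ε∈        = refl
    ; ∙-closed  = λ x≈ε y≈ε → trans (∙-cong x≈ε y≈ε) (identityˡ ε)
    ; ⁻¹-closed = λ x≈ε → trans (⁻¹-cong x≈ε) (solve {0} (inv one) one ≡.refl []) }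

  ∩-subgroup : ∀ {S T} → IsSubgroup S → IsSubgroup T → IsSubgroup (S ∩ T)
  ∩-subgroup s t = record
    { resp      = λ q (x , y) → resp s q x , resp t q y
    ; ε∈        = ε∈ s , ε∈ t
    ; ∙-closed  = λ (x , y) (x' , y') → ∙-closed s x x' , ∙-closed t y y'
    ; ⁻¹-closed = λ (x , y) → ⁻¹-closed s x , ⁻¹-closed t y }

  ⋂-subgroup : ∀ {I : Set ℓ} {F : I → Subset} (P : I → Set ℓ) →
               (∀ v → P v → IsSubgroup (F v)) → IsSubgroup (λ x → ∀ v → P v → F v x)
  ⋂-subgroup P s = record
    { resp      = λ q x v p → resp (s v p) q (x v p)
    ; ε∈        = λ v p → ε∈ (s v p)
    ; ∙-closed  = λ x y v p → ∙-closed (s v p) (x v p) (y v p)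
    ; ⁻¹-closed = λ x v p → ⁻¹-closed (s v p) (x v p) }

  conjugate-subgroup : ∀ {D} g → IsSubgroup D → IsSubgroup (λ x → D ((g ⁻¹ ∙ x) ∙ g))
  conjugate-subgroup g s = record
    { resp      = λ q → resp s (∙-congʳ (∙-congˡ q))
    ; ε∈        = resp s (solve {1} one (conjᵗ⁻ x₀ one) ≡.refl (g ∷ [])) (ε∈ s)
    ; ∙-closed  = λ {x} {y} dx dy → resp s
        (solve (conjᵗ⁻ x₀ x₁ · conjᵗ⁻ x₀ x₂) (conjᵗ⁻ x₀ (x₁ · x₂)) ≡.refl (g ∷ x ∷ y ∷ []))
        (∙-closed s dx dy)
    ; ⁻¹-closed = λ {x} dx → resp s
        (solve (inv (conjᵗ⁻ x₀ x₁)) (conjᵗ⁻ x₀ (inv x₁)) ≡.refl (g ∷ x ∷ [])) (⁻¹-closed s dx) }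

  normalizer-subgroup : ∀ {S} → (∀ {x y} → x ≈ y → S x → S y) → IsSubgroup (λ h → Normalizes h S)
  normalizer-subgroup {S} S-resp = record
    { resp = λ q (n , n⁻) →
        (λ x sx → S-resp (conj-cong q refl) (n x sx)) ,
        (λ x sx → S-resp (∙-cong (∙-congʳ (⁻¹-cong q)) q) (n⁻ x sx))
    ; ε∈ = (λ x sx → S-resp (sym (conj-ε x)) sx) ,
           (λ x sx → S-resp (solve {1} x₀ (conjᵗ⁻ one x₀) ≡.refl (x ∷ [])) sx)
    ; ∙-closed = λ {h} {k} (n , n⁻) (m , m⁻) →
        (λ x sx → S-resp (sym (conj-∙ h k x)) (n _ (m x sx))) ,
        (λ x sx → S-resp (solve (conjᵗ⁻ x₁ (conjᵗ⁻ x₀ x₂)) (conjᵗ⁻ (x₀ · x₁) x₂) ≡.refl (h ∷ k ∷ x ∷ []))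
                         (m⁻ _ (n⁻ x sx)))
    ; ⁻¹-closed = λ {h} (n , n⁻) →
        (λ x sx → S-resp (solve (conjᵗ⁻ x₀ x₁) (conjᵗ (inv x₀) x₁) ≡.refl (h ∷ x ∷ [])) (n⁻ x sx)) ,
        (λ x sx → S-resp (solve (conjᵗ x₀ x₁) (conjᵗ⁻ (inv x₀) x₁) ≡.refl (h ∷ x ∷ [])) (n x sx)) }

  -- If M normalizes the subgroup D then {x ∈ M : [x , a] ∈ D} is a subgroup,
  -- by [x y , a] = [x , a]^y [y , a] and [x⁻¹ , a] = ([x , a]⁻¹)^(x⁻¹).
  commutator-subgroup : ∀ {M D} a → IsSubgroup M → IsSubgroup D → (∀ h → M h → Normalizes h D) →
                        IsSubgroup (λ x → M x × D [ x , a ])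
  commutator-subgroup a sM sD M-norm = record
    { resp      = λ q (mx , dx) → resp sM q mx , resp sD (comm-congˡ a q) dx
    ; ε∈        = ε∈ sM , resp sD (sym (comm-ε a)) (ε∈ sD)
    ; ∙-closed  = λ {x} {y} (mx , dx) (my , dy) → ∙-closed sM mx my ,
        resp sD (sym (comm-∙ x y a))
          (∙-closed sD (resp sD (conj⁻ y _) (proj₂ (M-norm y my) _ dx)) dy)
    ; ⁻¹-closed = λ {x} (mx , dx) → ⁻¹-closed sM mx ,
        resp sD (sym (comm-inv x a)) (proj₁ (M-norm x mx) _ (⁻¹-closed sD dx)) }

  commutator-closed : ∀ {S g h} → IsSubgroup S → S g → S h → S [ g , h ]
  commutator-closed s g∈ h∈ =
    ∙-closed s (∙-closed s (∙-closed s (⁻¹-closed s g∈) (⁻¹-closed s h∈)) g∈) h∈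

  conj-closed : ∀ {S g x} → IsSubgroup S → S g → S x → S (conj g x)
  conj-closed s g∈ x∈ = ∙-closed s (∙-closed s g∈ x∈) (⁻¹-closed s g∈)

  definable-normalizer : ∀ {S} → Definable S → Definable (λ h → Normalizes h S)
  definable-normalizer {S} d = toDefinable (expr-⇔ {Q' = λ ρ → Normalizes (head ρ) S}
    (expr-∧ (expr-∀ (expr-⇒ (expr-subst E (λ _ → x₀)) (expr-subst E (λ _ → conjᵗ x₁ x₀))))
            (expr-∀ (expr-⇒ (expr-subst E (λ _ → x₀)) (expr-subst E (λ _ → conjᵗ⁻ x₁ x₀)))))
    (λ { (h ∷ []) → mk⇔ id id }))
    where E = fromDefinable d

-- In an icc-group an intersection of a family of φ-definable subgroups is
-- definable, because it coincides with a finite sub-intersection.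
module ChainCondition {ℓ : Level} (X : Group ℓ ℓ) (em : ExcludedMiddle ℓ)
                      (icc : GroupTheory.IsICC X) where
  open Group X
  open GroupTheory X
  open Expressibility X

  module _ {m} (φ : Formula (suc m)) (P : Vec Carrier m → Set ℓ)
           (φ-subgroup : ∀ ā → P ā → IsSubgroup (DefSet φ ā)) where

    ⋂P : Subset
    ⋂P g = ∀ ā → P ā → DefSet φ ā g

    ⋂below : (ℕ → Vec Carrier m) → ℕ → Subset
    ⋂below s j g = ∀ i → i < j → DefSet φ (s i) g

    Descending : ℕ → (ℕ → Vec Carrier m) → Set ℓ
    Descending k s = ∀ t → t < k → P (s t) × Σ Carrier λ g → ⋂below s t g × ¬ DefSet φ (s t) g

    FiniteSubfamily : Set ℓ
    FiniteSubfamily = Σ ℕ λ j → Σ (ℕ → Vec Carrier m) λ s →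
                        (∀ t → t < j → P (s t)) × (⋂below s j ⊆ ⋂P)

    _[_≔_] : (ℕ → Vec Carrier m) → ℕ → Vec Carrier m → ℕ → Vec Carrier m
    (s [ k ≔ ā ]) i with i ≟ k
    ... | yes _ = ā
    ... | no _  = s i

    ≔-below : ∀ s k ā {i} → i < k → (s [ k ≔ ā ]) i ≡ s i
    ≔-below s k ā {i} i<k with i ≟ k
    ... | yes i≡k = ⊥-elim (<-irrefl i≡k i<k)
    ... | no _    = ≡.refl

    ≔-at : ∀ s k ā → (s [ k ≔ ā ]) k ≡ ā
    ≔-at s k ā with k ≟ k
    ... | yes _  = ≡.refl
    ... | no k≢k = ⊥-elim (k≢k ≡.refl)

    ⋂below-≔ : ∀ s k ā {t} → t ≤ k → ∀ g → ⋂below (s [ k ≔ ā ]) t g ⇔ ⋂below s t g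
    ⋂below-≔ s k ā t≤k g = mk⇔
      (λ h i i<t → ≡.subst (λ v → DefSet φ v g) (≔-below s k ā (<-≤-trans i<t t≤k)) (h i i<t))
      (λ h i i<t → ≡.subst (λ v → DefSet φ v g) (≡.sym (≔-below s k ā (<-≤-trans i<t t≤k))) (h i i<t))

    -- Either the first k members already cut out ⋂P, or (by excluded middle)
    -- some member omits an element of their intersection and prolongs the chain.
    extend : ∀ k s → Descending k s → FiniteSubfamily ⊎ Σ (ℕ → Vec Carrier m) (Descending (suc k))
    extend k s desc
      with em {Σ Carrier λ g → Σ (Vec Carrier m) λ ā → ⋂below s k g × P ā × ¬ DefSet φ ā g}
    ... | no none = inj₁ (k , s , (λ t t<k → proj₁ (desc t t<k)) ,
                          λ g g∈ ā pā → decidable-stable em (λ g∉ → none (g , ā , g∈ , pā , g∉)))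
    ... | yes (g , ā , g∈ , pā , g∉) = inj₂ (s [ k ≔ ā ] , desc')
      where
        desc' : Descending (suc k) (s [ k ≔ ā ])
        desc' t t<1+k with m<1+n⇒m<n∨m≡n t<1+k
        ... | inj₁ t<k =
          let (pt , h , h∈ , h∉) = desc t t<k ; eq = ≔-below s k ā t<k in
          ≡.subst P (≡.sym eq) pt , h , from (⋂below-≔ s k ā (<⇒≤ t<k) h) h∈ ,
          h∉ ∘ ≡.subst (λ v → DefSet φ v h) eq
        ... | inj₂ ≡.refl =
          ≡.subst P (≡.sym (≔-at s k ā)) pā , g , from (⋂below-≔ s k ā ≤-refl g) g∈ ,
          g∉ ∘ ≡.subst (λ v → DefSet φ v g) (≔-at s k ā)

    descend : ∀ k → FiniteSubfamily ⊎ Σ (ℕ → Vec Carrier m) (Descending k)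
    descend zero    = inj₂ ((λ _ → replicate m ε) , λ t ())
    descend (suc k) with descend k
    ... | inj₁ found      = inj₁ found
    ... | inj₂ (s , desc) = extend k s desc

    -- A descending sequence gives a chain ⋂below s 0 ⊋ … ⊋ ⋂below s k of
    -- φ-intersections, so k is at most the icc bound for φ.
    descending-bound : ∀ k s → Descending k s → k ≤ proj₁ (icc m φ)
    descending-bound k s desc = proj₂ (icc m φ) k (⋂below s ∘ toℕ) is-φ-intersection shrinking
      where
        is-φ-intersection : ∀ j → IsφIntersection φ (⋂below s (toℕ j))
        is-φ-intersection j = (λ ā → ∃ λ i → i < toℕ j × s i ≡ ā) ,
          (λ { ā (i , i<j , ≡.refl) →
                 φ-subgroup (s i) (proj₁ (desc i (<-≤-trans i<j (toℕ≤pred[n] j)))) }) ,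
          (λ g g∈ → λ { ā (i , i<j , ≡.refl) → g∈ i i<j }) ,
          (λ g g∈ i i<j → g∈ (s i) (i , i<j , ≡.refl))

        shrinking : ∀ (j : Fin k) → ⋂below s (toℕ (fsuc j)) ⊂ ⋂below s (toℕ (inject₁ j))
        shrinking j rewrite toℕ-inject₁ j =
          (λ g g∈ i i<j → g∈ i (m<n⇒m<1+n i<j)) ,
          (λ ⊇ → let (_ , g , g∈ , g∉) = desc (toℕ j) (toℕ<n j) in
                 g∉ (⊇ g g∈ (toℕ j) (n<1+n _)))

    finite-subfamily : FiniteSubfamily
    finite-subfamily with descend (suc (proj₁ (icc m φ)))
    ... | inj₁ found      = found
    ... | inj₂ (s , desc) = ⊥-elim (<-irrefl ≡.refl (descending-bound _ s desc))

    definable-⋂below : ∀ s j → Definable (⋂below s j)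
    definable-⋂below s zero = definable-⇔ U-definable (λ g → mk⇔ (λ _ i ()) (λ _ → tt))
    definable-⋂below s (suc j) =
      definable-⇔ (definable-∩ (definable-⋂below s j) (m , φ , s j , (λ _ → id) , (λ _ → id))) split
      where
        add : ∀ {g i} → ⋂below s j g → DefSet φ (s j) g → i < j ⊎ i ≡ j → DefSet φ (s i) g
        add below last (inj₁ i<j)   = below _ i<j
        add below last (inj₂ ≡.refl) = last

        split : ∀ g → (⋂below s j g × DefSet φ (s j) g) ⇔ ⋂below s (suc j) g
        split g = mk⇔ (λ (below , last) i i<1+j → add below last (m<1+n⇒m<n∨m≡n i<1+j))
                      (λ h → (λ i i<j → h i (m<n⇒m<1+n i<j)) , h j (n<1+n j))

    definable-⋂P : Definable ⋂P
    definable-⋂P = let (j , s , s∈P , below⊆) = finite-subfamily in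
      definable-⇔ (definable-⋂below s j) (λ g → mk⇔ (below⊆ g) (λ g∈ i i<j → g∈ (s i) (s∈P i i<j)))

module RelativeDefinability {ℓ : Level} (X : Group ℓ ℓ) (em : ExcludedMiddle ℓ)
                            (icc : GroupTheory.IsICC X) where
  open Group X
  open GroupTheory X
  open Expressibility X
  open Words X
  open Subgroups X
  open ChainCondition X em icc using (definable-⋂P)
  open IsSubgroup

  module NormalCore (G : Subset) (G-subgroup : IsSubgroup G)
                    (D : Subset) (D-subgroup : IsSubgroup D) (D-definable : Definable D)
                    (S : Subset) (S≗D∩G : S ≗ (D ∩ G)) where

    N-subgroup : IsSubgroup (λ h → Normalizes h S)
    N-subgroup = normalizer-subgroup (resp (subgroup-≗ (∩-subgroup D-subgroup G-subgroup) S≗D∩G))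

    D∩Dᵍ : Expressible 2 (λ ρ → D (lookup ρ fzero) ×
                                D ((lookup ρ (fsuc fzero) ⁻¹ ∙ lookup ρ fzero) ∙ lookup ρ (fsuc fzero)))
    D∩Dᵍ = expr-∧ (expr-subst (fromDefinable D-definable) (λ _ → x₀))
                  (expr-subst (fromDefinable D-definable) (λ _ → conjᵗ⁻ x₁ x₀))

    open Expressible D∩Dᵍ using (arity) renaming (formula to ψ)

    b̄ : Vec Carrier arity
    b̄ = Expressible.params D∩Dᵍ

    ψ-meaning : ∀ x g → DefSet ψ (g ∷ b̄) x ⇔ (D x × D ((g ⁻¹ ∙ x) ∙ g))
    ψ-meaning x g = Expressible.meaning D∩Dᵍ (x ∷ g ∷ [])

    Index : Vec Carrier (suc arity) → Set ℓ
    Index (g ∷ c̄) = G g × Normalizes g S × c̄ ≡ b̄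

    ψ-subgroup : ∀ v → Index v → IsSubgroup (DefSet ψ v)
    ψ-subgroup (g ∷ .b̄) (_ , _ , ≡.refl) =
      subgroup-⇔ (∩-subgroup D-subgroup (conjugate-subgroup g D-subgroup)) (λ x → ⇔-sym (ψ-meaning x g))

    D* : Subset
    D* x = ∀ v → Index v → DefSet ψ v x

    D*-subgroup : IsSubgroup D*
    D*-subgroup = ⋂-subgroup Index ψ-subgroup

    D*-definable : Definable D*
    D*-definable = definable-⋂P ψ Index ψ-subgroup

    S≗D*∩G : S ≗ (D* ∩ G)
    S≗D*∩G = (λ x x∈S → (λ { (g ∷ .b̄) (_ , g-norm , ≡.refl) →
                               from (ψ-meaning x g) (S⊆D x∈S , S⊆D (proj₂ g-norm x x∈S)) }) ,
                         proj₂ (proj₁ S≗D∩G x x∈S)) ,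
             (λ x (x∈D* , x∈G) → proj₂ S≗D∩G x (proj₁ (to (ψ-meaning x ε)
                (x∈D* (ε ∷ b̄) (ε∈ G-subgroup , ε∈ N-subgroup , ≡.refl))) , x∈G))
      where
        S⊆D : ∀ {x} → S x → D x
        S⊆D {x} x∈S = proj₁ (proj₁ S≗D∩G x x∈S)

    -- Conjugation by h ∈ N_G(S) maps D* into itself: for g ∈ N_G(S),
    -- h x h⁻¹ ∈ D ∩ D^g because x ∈ D^{h⁻¹} ∩ D^{h⁻¹ g}.
    D*-conj : ∀ h → G h → Normalizes h S → ∀ x → D* x → D* (conj h x)
    D*-conj h h∈G h-norm x x∈D* (g ∷ .b̄) (g∈G , g-norm , ≡.refl) =
      from (ψ-meaning (conj h x) g) (in-D , in-Dᵍ)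
      where
        in-D : D (conj h x)
        in-D = resp D-subgroup (solve (conjᵗ⁻ (inv x₀) x₁) (conjᵗ x₀ x₁) ≡.refl (h ∷ x ∷ []))
          (proj₂ (to (ψ-meaning x (h ⁻¹)) (x∈D* (h ⁻¹ ∷ b̄)
            (⁻¹-closed G-subgroup h∈G , ⁻¹-closed N-subgroup h-norm , ≡.refl))))

        in-Dᵍ : D ((g ⁻¹ ∙ conj h x) ∙ g)
        in-Dᵍ = resp D-subgroup
          (solve (conjᵗ⁻ (inv x₀ · x₁) x₂) (conjᵗ⁻ x₁ (conjᵗ x₀ x₂)) ≡.refl (h ∷ g ∷ x ∷ []))
          (proj₂ (to (ψ-meaning x (h ⁻¹ ∙ g)) (x∈D* (h ⁻¹ ∙ g ∷ b̄)
            (∙-closed G-subgroup (⁻¹-closed G-subgroup h∈G) g∈G ,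
             ∙-closed N-subgroup (⁻¹-closed N-subgroup h-norm) g-norm , ≡.refl))))

    normalizes-S⇔D* : ∀ h → G h → Normalizes h S ⇔ Normalizes h D*
    normalizes-S⇔D* h h∈G = mk⇔
      (λ h-norm → D*-conj h h∈G h-norm ,
        (λ x x∈D* → resp D*-subgroup (solve (conjᵗ (inv x₀) x₁) (conjᵗ⁻ x₀ x₁) ≡.refl (h ∷ x ∷ []))
           (D*-conj (h ⁻¹) (⁻¹-closed G-subgroup h∈G) (⁻¹-closed N-subgroup h-norm) x x∈D*)))
      (λ (n , n⁻) →
        (λ x x∈S → let (x∈D* , x∈G) = proj₁ S≗D*∩G x x∈S in
           proj₂ S≗D*∩G _ (n x x∈D* , conj-closed G-subgroup h∈G x∈G)) ,
        (λ x x∈S → let (x∈D* , x∈G) = proj₁ S≗D*∩G x x∈S in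
           proj₂ S≗D*∩G _ (n⁻ x x∈D* , resp G-subgroup (sym (conj⁻ h x))
             (conj-closed G-subgroup (⁻¹-closed G-subgroup h∈G) x∈G))))

  module IteratedCentralizers (G A H : Subset) (G-subgroup : IsSubgroup G) (A⊆G : A ⊆ G)
           (H-subgroup : IsSubgroup H) (H⊆G : H ⊆ G) (DH : Subset) (DH-subgroup : IsSubgroup DH)
           (DH-definable : Definable DH) (H≗DH∩G : H ≗ (DH ∩ G)) where

    record Stage (i : ℕ) : Set (lsuc ℓ) where
      field
        D              : Subset
        D-subgroup     : IsSubgroup D
        D-definable    : Definable D
        C≗D∩G          : C H A i ≗ (D ∩ G)
        M              : Subset
        M-subgroup     : IsSubgroup M
        M-definable    : Definable M
        M∩G            : ∀ h → G h → M h ⇔ (H h × NormAll H A i h)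
        M-normalizes-D : ∀ h → M h → Normalizes h D

    -- A stage is obtained from any definable D with C^i_H(A) = D ∩ G and a
    -- definable M' cutting out on G a condition Q such that Q and "normalizes
    -- C^i_H(A)" together are the stage-i condition: pass to the normal core D*
    -- of D and take M = M' ∩ N(D*), using that on G, N(D*) = N(C^i_H(A)).
    complete : ∀ i {D M' : Subset} {Q : Carrier → Set ℓ} → IsSubgroup D → Definable D → C H A i ≗ (D ∩ G) →
               IsSubgroup M' → Definable M' → (∀ h → G h → M' h ⇔ Q h) →
               (∀ h → (Q h × Normalizes h (C H A i)) ⇔ (H h × NormAll H A i h)) → Stage i
    complete i {D} D-subgroup D-definable C≗ M'-subgroup M'-definable M'∩G reshape = record
      { D              = core.D*
      ; D-subgroup     = core.D*-subgroup
      ; D-definable    = core.D*-definable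
      ; C≗D∩G          = core.S≗D*∩G
      ; M              = _ ∩ (λ h → Normalizes h core.D*)
      ; M-subgroup     = ∩-subgroup M'-subgroup (normalizer-subgroup (resp core.D*-subgroup))
      ; M-definable    = definable-∩ M'-definable (definable-normalizer core.D*-definable)
      ; M∩G            = λ h h∈G →
          reshape h ⇔-∘ (M'∩G h h∈G ×-⇔ ⇔-sym (core.normalizes-S⇔D* h h∈G))
      ; M-normalizes-D = λ h → proj₂ }
      where module core = NormalCore G G-subgroup D D-subgroup D-definable (C H A i) C≗

    stage₀ : Stage 0
    stage₀ = complete 0 {Q = H} trivial-subgroup (toDefinable (expr-≈ x₀ one)) C₀≗
                      DH-subgroup DH-definable DH∩G (λ h → mk⇔ id id)
      where
        C₀≗ : C H A 0 ≗ ((λ x → x ≈ ε) ∩ G)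
        C₀≗ = (λ x (x∈H , x≈ε) → x≈ε , H⊆G x x∈H) ,
              (λ x (x≈ε , _) → resp H-subgroup (sym x≈ε) (ε∈ H-subgroup) , x≈ε)

        DH∩G : ∀ h → G h → DH h ⇔ H h
        DH∩G h h∈G = mk⇔ (λ h∈DH → proj₂ H≗DH∩G h (h∈DH , h∈G)) (λ h∈H → proj₁ (proj₁ H≗DH∩G h h∈H))

    -- C^{i+1}_H(A) = (M ∩ ⋂_{a ∈ A} {x ∈ M : [x , a] ∈ D}) ∩ G; the intersection is
    -- uniformly definable by a formula χ(x; a, b̄), hence definable by the chain condition.
    stage-suc : ∀ i → Stage i → Stage (suc i)
    stage-suc i stage =
      complete (suc i) {Q = λ h → H h × NormAll H A i h} (∩-subgroup M-subgroup (⋂-subgroup Params χ-subgroup))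
        (definable-∩ M-definable (definable-⋂P χ Params χ-subgroup)) C≗
        M-subgroup M-definable M∩G
        (λ h → mk⇔ (λ ((h∈H , n) , n') → h∈H , n , n') (λ (h∈H , n , n') → (h∈H , n) , n'))
      where
        open Stage stage

        M∩Cᴰ : Expressible 2 (λ ρ → M (lookup ρ fzero) × D [ lookup ρ fzero , lookup ρ (fsuc fzero) ])
        M∩Cᴰ = expr-∧ (expr-subst (fromDefinable M-definable) (λ _ → x₀))
                      (expr-subst (fromDefinable D-definable) (λ _ → commᵗ x₀ x₁))

        open Expressible M∩Cᴰ using (arity) renaming (formula to χ)

        b̄ : Vec Carrier arity
        b̄ = Expressible.params M∩Cᴰ

        χ-meaning : ∀ x a → DefSet χ (a ∷ b̄) x ⇔ (M x × D [ x , a ])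
        χ-meaning x a = Expressible.meaning M∩Cᴰ (x ∷ a ∷ [])

        Params : Vec Carrier (suc arity) → Set ℓ
        Params (a ∷ c̄) = A a × c̄ ≡ b̄

        χ-subgroup : ∀ v → Params v → IsSubgroup (DefSet χ v)
        χ-subgroup (a ∷ .b̄) (_ , ≡.refl) = subgroup-⇔
          (commutator-subgroup a M-subgroup D-subgroup M-normalizes-D) (λ x → ⇔-sym (χ-meaning x a))

        C≗ : C H A (suc i) ≗ ((M ∩ (λ x → ∀ v → Params v → DefSet χ v x)) ∩ G)
        C≗ = (λ h (h∈H , n , comm) →
                let h∈G = H⊆G h h∈H ; h∈M = from (M∩G h h∈G) (h∈H , n) in
                (h∈M , λ { (a ∷ .b̄) (a∈A , ≡.refl) →
                  from (χ-meaning h a) (h∈M , proj₁ (proj₁ C≗D∩G _ (comm a a∈A))) }) , h∈G) ,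
             (λ h ((h∈M , h∈⋂) , h∈G) → let (h∈H , n) = to (M∩G h h∈G) h∈M in
                h∈H , n , λ a a∈A → proj₂ C≗D∩G _
                  (proj₂ (to (χ-meaning h a) (h∈⋂ (a ∷ b̄) (a∈A , ≡.refl))) ,
                   commutator-closed G-subgroup h∈G (A⊆G a a∈A)))

    stage : ∀ i → Stage i
    stage zero    = stage₀
    stage (suc i) = stage-suc i (stage i)

    relativelyDefinable-C : ∀ i → RelDefinable G (C H A i)
    relativelyDefinable-C i = let open Stage (stage i) in D , (D-subgroup , D-definable) , C≗D∩G

module UpperCentralSeries {ℓ : Level} (X : Group ℓ ℓ) (G : GroupTheory.Subset X)
                          (G-subgroup : GroupTheory.IsSubgroup X G) where
  open Group X
  open GroupTheory X
  open Words X
  open Subgroups X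
  open IsSubgroup

  Z-resp : ∀ i {g g'} → g ≈ g' → Z G i g → Z G i g'
  Z-resp zero    q (g∈G , g≈ε)     = resp G-subgroup q g∈G , trans (sym q) g≈ε
  Z-resp (suc i) q (g∈G , central) =
    resp G-subgroup q g∈G , λ x x∈G → Z-resp i (comm-congˡ x q) (central x x∈G)

  -- Z_i(G) is normal in G, using [g x g⁻¹ , y] = g [x , g⁻¹ y g] g⁻¹.
  Z-conj : ∀ i {g x} → G g → Z G i x → Z G i (conj g x)
  Z-conj zero {g} g∈G (x∈G , x≈ε) = conj-closed G-subgroup g∈G x∈G ,
    trans (conj-cong refl x≈ε) (solve {1} (conjᵗ x₀ one) one ≡.refl (g ∷ []))
  Z-conj (suc i) {g} {x} g∈G (x∈G , central) = conj-closed G-subgroup g∈G x∈G , λ y y∈G →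
    Z-resp i (sym (comm-conj g x y))
      (Z-conj i g∈G (central _ (conj-closed G-subgroup (⁻¹-closed G-subgroup g∈G) y∈G)))

  -- The normalizer conditions in C^i_G(G) hold automatically, since each term is normal.
  mutual
    Z⇔C : ∀ i h → Z G i h ⇔ C G G i h
    Z⇔C zero    h = mk⇔ id id
    Z⇔C (suc i) h = mk⇔
      (λ (h∈G , central) → h∈G , normalizes-all i h∈G , λ a a∈G → to (Z⇔C i _) (central a a∈G))
      (λ (h∈G , _ , central) → h∈G , λ x x∈G → from (Z⇔C i _) (central x x∈G))

    normalizes-C : ∀ i {h} → G h → Normalizes h (C G G i)
    normalizes-C i {h} h∈G =
      (λ x x∈C → to (Z⇔C i _) (Z-conj i h∈G (from (Z⇔C i x) x∈C))) ,
      (λ x x∈C → to (Z⇔C i _) (Z-resp i (sym (conj⁻ h x))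
                   (Z-conj i (⁻¹-closed G-subgroup h∈G) (from (Z⇔C i x) x∈C))))

    normalizes-all : ∀ i {h} → G h → NormAll G G i h
    normalizes-all zero    h∈G = normalizes-C zero h∈G
    normalizes-all (suc i) h∈G = normalizes-all i h∈G , normalizes-C (suc i) h∈G

module Lemma2p3 {ℓ : Level} (X : Group ℓ ℓ) (em : ExcludedMiddle ℓ) (icc : GroupTheory.IsICC X) where
  open GroupTheory X
  open Expressibility X
  open Subgroups X
  open RelativeDefinability X em icc
  open IteratedCentralizers using (relativelyDefinable-C)

  relDefinable-⇔ : ∀ {G S S'} → RelDefinable G S → (∀ x → S x ⇔ S' x) → RelDefinable G S'
  relDefinable-⇔ (D , D-sg-def , S⊆ , ⊆S) e =
    D , D-sg-def , (λ x x∈S' → S⊆ x (from (e x) x∈S')) , (λ x x∈D∩G → to (e x) (⊆S x x∈D∩G))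

  relativelyDefinable-Z : ∀ G → IsSubgroup G → ∀ i → RelDefinable G (Z G i)
  relativelyDefinable-Z G G-sg i = relDefinable-⇔
    (relativelyDefinable-C G G G G-sg (λ _ → id) G-sg (λ _ → id) U U-subgroup U-definable G≗U∩G i)
    (λ x → ⇔-sym (Z⇔C i x))
    where
      open UpperCentralSeries X G G-sg using (Z⇔C)

      G≗U∩G : G ≗ (U ∩ G)
      G≗U∩G = (λ _ g∈G → tt , g∈G) , (λ _ → proj₂)

  relative : ∀ (G A H : Subset) → IsSubgroup G → A ⊆ G → IsSubgroup H → H ⊆ G →
             RelDefinable G H → ∀ i → RelDefinable G (C H A i) × RelDefinable G (Z G i)
  relative G A H G-sg A⊆G H-sg H⊆G (DH , (DH-sg , DH-def) , H≗DH∩G) i =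
    relativelyDefinable-C G A H G-sg A⊆G H-sg H⊆G DH DH-sg DH-def H≗DH∩G i ,
    relativelyDefinable-Z G G-sg i

  relative⇒definable : ∀ {S} → RelDefinable U S → Definable S
  relative⇒definable (D , (_ , D-def) , S⊆ , ⊆S) =
    definable-⇔ D-def (λ x → mk⇔ (λ x∈D → ⊆S x (x∈D , tt)) (λ x∈S → proj₁ (S⊆ x x∈S)))

  absolute : ∀ (A : Subset) i → Definable (C U A i) × Definable (Z U i)
  absolute A i =
    let (C-rel , Z-rel) = relative U A U U-subgroup (λ _ _ → tt) U-subgroup (λ _ _ → tt) U-rel i
    in relative⇒definable C-rel , relative⇒definable Z-rel
    where
      U-rel : RelDefinable U U
      U-rel = U , (U-subgroup , U-definable) , (λ _ t → t , t) , (λ _ → proj₁)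

lemma2p3 : ∀ {ℓ : Level} → ExcludedMiddle ℓ → (X : Group ℓ ℓ) →
    let open GroupTheory X in
    (IsICC → ∀ (A : Subset) (i : ℕ) → Definable (C U A i) × Definable (Z U i))
    ×
    (IsICC → ∀ (G A H : Subset) → IsSubgroup G → A ⊆ G →
      IsSubgroup H → H ⊆ G → RelDefinable G H →
      ∀ (i : ℕ) → RelDefinable G (C H A i) × RelDefinable G (Z G i))
lemma2p3 em X = (λ icc → Lemma2p3.absolute X em icc) , (λ icc → Lemma2p3.relative X em icc)
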